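{- Let $(S,+)$ be a commutative cancellative semigroup and let $S-S$ denote its difference group. If $A\subseteq S$ is a $J$-set in $S$, then $A$ is a $J$-set in $S-S$.
   Context: For a commutative cancellative semigroup $(S,+)$, the difference group $(S-S,+)$ consists of all $a-b$ with $a,b\in S$, where $a-b$ is the element with $b+(a-b)=a$; it is a commutative group and $S\subseteq S-S$. For a set $Y$, $\mathcal P_f(Y)$ is the set of finite nonempty subsets of $Y$. For a semigroup $(X,\cdot)$ (written additively when commutative), let $\mathcal T_X={}^{\mathbb N}X$ be the set of sequences in $X$; for $m\in\mathbb N$ let $\mathcal J_m=\{(t(1),\dots,t(m))\in\mathbb N^m: t(1)<\dots<t(m)\}$; for $a\in X^{m+1}$, $t\in\mathcal J_m$, $f\in\mathcal T_X$ put $x(m,a,t,f)=\bigl(\prod_{j=1}^m a(j)\cdot f(t(j))\bigr)\cdot a(m+1)$. A set $B\subseteq X$ is a $J$-set in $X$ if for each $F\in\mathcal P_f(\mathcal T_X)$ there exist $m\in\mathbb N$, $a\in X^{m+1}$, $t\in\mathcal J_m$ such that $x(m,a,t,f)\in B$ for every $f\in F$. (In the commutative additive case this says: for each finite set $F$ of sequences in $X$ there are $a\in X$ and a finite nonempty $K\subseteq\mathbb N$ with $a+\sum_{t\in K}f(t)\in B$ for all $f\in F$.) -}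

module Defs where

open import Level using (Level; _⊔_)
open import Data.Nat using (ℕ; zero; suc; _<_)
open import Data.Fin using (Fin; inject₁; fromℕ) renaming (zero to fzero; suc to fsuc; _<_ to _<ᶠ_)
open import Data.Product using (Σ; _×_; _,_; ∃-syntax)
open import Data.List using (List; []; _∷_)
open import Data.List.Relation.Unary.All using (All)
open import Relation.Unary using (Pred)
open import Algebra.Core using (Op₂)
open import Algebra.Bundles using (CommutativeSemigroup)
open import Algebra.Definitions using (Cancellative)

prod⁺ : ∀ {c} {X : Set c} → Op₂ X → (k : ℕ) → (Fin (suc k) → X) → X
prod⁺ _·_ zero    u = u fzero
prod⁺ _·_ (suc k) u = u fzero · prod⁺ _·_ k (λ j → u (fsuc j))

StrictInc : ∀ {m} → (Fin m → ℕ) → Set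
StrictInc {m} t = ∀ (i j : Fin m) → i <ᶠ j → t i < t j

-- x(m,a,t,f) = (∏_{j=1}^m a(j)·f(t(j)))·a(m+1),  with m = suc k
xJ : ∀ {c} {X : Set c} → Op₂ X → (k : ℕ) → (Fin (suc (suc k)) → X) →
     (Fin (suc k) → ℕ) → (ℕ → X) → X
xJ _·_ k a t f = prod⁺ _·_ k (λ j → a (inject₁ j) · f (t j)) · a (fromℕ (suc k))

-- Finite nonempty sets of sequences are represented by nonempty lists.
IsJSet : ∀ {c ℓ} (X : Set c) → Op₂ X → Pred X ℓ → Set (c ⊔ ℓ)
IsJSet X _·_ B =
  (f₀ : ℕ → X) (F : List (ℕ → X)) →
  ∃[ k ] Σ (Fin (suc (suc k)) → X) λ a → Σ (Fin (suc k) → ℕ) λ t →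
    StrictInc t × All (λ f → B (xJ _·_ k a t f)) (f₀ ∷ F)

module DifferenceGroup {c ℓ} (S : CommutativeSemigroup c ℓ) where
  open CommutativeSemigroup S renaming (Carrier to Sc)

  -- elements of S - S: formal differences (a , b) standing for a - b
  Diff : Set c
  Diff = Sc × Sc

  _≈D_ : Diff → Diff → Set ℓ
  (a , b) ≈D (c' , d) = (a ∙ d) ≈ (c' ∙ b)

  _+D_ : Op₂ Diff
  (a , b) +D (c' , d) = (a ∙ c' , b ∙ d)

  -- a subset A ⊆ S viewed as a subset of S - S (via S ⊆ S - S):
  -- p - q ∈ A  iff  p - q = s for some s ∈ A, i.e. q + s = p
  inDiff : ∀ {ℓ'} → Pred Sc ℓ' → Pred Diff (c ⊔ ℓ ⊔ ℓ')
  inDiff A (p , q) = Σ Sc λ s → A s × ((q ∙ s) ≈ p)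

module Submission where

-- Idea: clear denominators.  Given finitely many sequences g(n) = p_g(n) - q_g(n)
-- in S - S, let W(n) = q_{g₁}(n) + ... + q_{g_r}(n) + e (any e ∈ S).  Each q_g(n)
-- divides W(n) additively, q_g(n) + R_g(n) = W(n), so g(n) = h_g(n) - W(n) with
-- h_g(n) = p_g(n) + R_g(n) ∈ S.  The J-set property of A in S, applied to the
-- sequences h_g, yields a ∈ S^{m+1} and t ∈ 𝒥_m with x(m,a,t,h_g) ∈ A.  In S - S
-- take a'(j) = a(j) + W(t(j)) for j ≤ m and a'(m+1) = a(m+1): the W(t(j)) cancel
-- the denominators, so x(m,a',t,g) = x(m,a,t,h_g) ∈ A.
--
-- Membership p - q ∈ A is witnessed by s ∈ A with q + s = p.

open import Level using (_⊔_)
open import Defs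
open import Relation.Unary using (Pred)
open import Algebra.Bundles using (CommutativeSemigroup)
open import Algebra.Definitions using (Cancellative)
open import Data.Nat using (ℕ; zero; suc)
open import Data.Fin using (Fin; inject₁; fromℕ) renaming (zero to fzero; suc to fsuc)
open import Data.Product using (Σ; _,_; proj₁; proj₂)
open import Data.List using (List; []; _∷_)
open import Data.List.Relation.Unary.All using (All; []; _∷_; reduce)
import Data.List.Relation.Unary.All as All
open import Relation.Binary.PropositionalEquality using (_≡_; refl; subst)
import Relation.Binary.Reasoning.Setoid as SetoidReasoning
import Algebra.Properties.CommutativeSemigroup as CommSemigroupProperties

snoc : ∀ {c} {X : Set c} (k : ℕ) → (Fin (suc k) → X) → X → Fin (suc (suc k)) → X
snoc zero    u x fzero        = u fzero
snoc zero    u x (fsuc fzero) = x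
snoc (suc k) u x fzero        = u fzero
snoc (suc k) u x (fsuc j)     = snoc k (λ i → u (fsuc i)) x j

snoc-inject₁ : ∀ {c} {X : Set c} (k : ℕ) (u : Fin (suc k) → X) (x : X) (j : Fin (suc k)) →
  snoc k u x (inject₁ j) ≡ u j
snoc-inject₁ zero    u x fzero    = refl
snoc-inject₁ (suc k) u x fzero    = refl
snoc-inject₁ (suc k) u x (fsuc j) = snoc-inject₁ k (λ i → u (fsuc i)) x j

snoc-last : ∀ {c} {X : Set c} (k : ℕ) (u : Fin (suc k) → X) (x : X) →
  snoc k u x (fromℕ (suc k)) ≡ x
snoc-last zero    u x = refl
snoc-last (suc k) u x = snoc-last k (λ i → u (fsuc i)) x

reduce⁻ : ∀ {a b p q r} {X : Set a} {B : Set b} {P : Pred X p} {Q : Pred B q} {R : Pred X r}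
  (f : ∀ {x} → P x → B) → (∀ {x} (px : P x) → Q (f px) → R x) →
  ∀ {xs} (ps : All P xs) → All Q (reduce f ps) → All R xs
reduce⁻ f g []       []         = []
reduce⁻ f g (p ∷ ps) (q ∷ qs) = g p q ∷ reduce⁻ f g ps qs

module _ {c ℓ} (S : CommutativeSemigroup c ℓ) where
  open CommutativeSemigroup S renaming (Carrier to Sc; refl to ≈-refl)
  open CommSemigroupProperties S using (interchange; x∙yz≈y∙xz; xy∙z≈xz∙y)
  open DifferenceGroup S
  open SetoidReasoning setoid

  _represents_ : Diff → Sc → Set ℓ
  (p , q) represents s = q ∙ s ≈ p

  embed : Sc → Sc → Diff
  embed e s = (s ∙ e , e)

  embed-represents : ∀ e s → embed e s represents s
  embed-represents e s = comm e s

  represents-+D : ∀ {d d' x y} → d represents x → d' represents y → (d +D d') represents (x ∙ y)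
  represents-+D {_ , q} {_ , q'} {x} {y} r r' = trans (interchange q q' x y) (∙-cong r r')

  represents-prod⁺ : ∀ k (u : Fin (suc k) → Diff) (z : Fin (suc k) → Sc) →
    (∀ j → u j represents z j) → prod⁺ _+D_ k u represents prod⁺ _∙_ k z
  represents-prod⁺ zero    u z r = r fzero
  represents-prod⁺ (suc k) u z r =
    represents-+D (r fzero) (represents-prod⁺ k (λ j → u (fsuc j)) (λ j → z (fsuc j)) (λ j → r (fsuc j)))

  represents-xJ : ∀ k (a' : Fin (suc (suc k)) → Diff) (a : Fin (suc (suc k)) → Sc)
    (t : Fin (suc k) → ℕ) (g : ℕ → Diff) (h : ℕ → Sc) →
    (∀ j → (a' (inject₁ j) +D g (t j)) represents (a (inject₁ j) ∙ h (t j))) →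
    a' (fromℕ (suc k)) represents a (fromℕ (suc k)) →
    xJ _+D_ k a' t g represents xJ _∙_ k a t h
  represents-xJ k a' a t g h inner last =
    represents-+D (represents-prod⁺ k _ _ inner) last

  represents-clear : ∀ {d s W p q R} → d represents (s ∙ W) → q ∙ R ≈ W →
    (d +D (p , q)) represents (s ∙ (p ∙ R))
  represents-clear {pd , qd} {s} {W} {p} {q} {R} rep qR≈W = begin
    (qd ∙ q) ∙ (s ∙ (p ∙ R)) ≈⟨ ∙-congˡ (x∙yz≈y∙xz s p R) ⟩
    (qd ∙ q) ∙ (p ∙ (s ∙ R)) ≈⟨ interchange qd q p (s ∙ R) ⟩
    (qd ∙ p) ∙ (q ∙ (s ∙ R)) ≈⟨ ∙-congˡ (x∙yz≈y∙xz q s R) ⟩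
    (qd ∙ p) ∙ (s ∙ (q ∙ R)) ≈⟨ ∙-congˡ (∙-congˡ qR≈W) ⟩
    (qd ∙ p) ∙ (s ∙ W)       ≈⟨ xy∙z≈xz∙y qd p (s ∙ W) ⟩
    (qd ∙ (s ∙ W)) ∙ p       ≈⟨ ∙-congʳ rep ⟩
    pd ∙ p                   ∎

  Cofactor : (ℕ → Sc) → (ℕ → Diff) → Set (c ⊔ ℓ)
  Cofactor W g = Σ (ℕ → Sc) λ R → ∀ n → proj₂ (g n) ∙ R n ≈ W n

  -- The numerator h(n) = p_g(n) + R(n), so that g(n) = h(n) - W(n).
  numerator : ∀ {W} g → Cofactor W g → ℕ → Sc
  numerator g (R , _) n = proj₁ (g n) ∙ R n

  cofactor-∙ˡ : ∀ {W g} (V : ℕ → Sc) → Cofactor W g → Cofactor (λ n → V n ∙ W n) g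
  cofactor-∙ˡ {g = g} V (R , qR≈W) =
    (λ n → V n ∙ R n) , λ n → trans (x∙yz≈y∙xz (proj₂ (g n)) (V n) (R n)) (∙-congˡ (qR≈W n))

  commonDenominator : Sc → List (ℕ → Diff) → ℕ → Sc
  commonDenominator e []      n = e
  commonDenominator e (g ∷ L) n = proj₂ (g n) ∙ commonDenominator e L n

  cofactors : ∀ e L → All (Cofactor (commonDenominator e L)) L
  cofactors e []      = []
  cofactors e (g ∷ L) =
    (commonDenominator e L , λ n → ≈-refl) ∷
    All.map (λ {h} → cofactor-∙ˡ {g = h} (λ n → proj₂ (g n))) (cofactors e L)

  module _ {ℓ'} (A : Pred Sc ℓ') where

    shiftedCoeffs : (ℕ → Sc) → ∀ k → (Fin (suc (suc k)) → Sc) → (Fin (suc k) → ℕ) →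
      Fin (suc (suc k)) → Sc
    shiftedCoeffs W k a t = snoc k (λ i → a (inject₁ i) ∙ W (t i)) (a (fromℕ (suc k)))

    liftCoeffs : Sc → (ℕ → Sc) → ∀ k → (Fin (suc (suc k)) → Sc) → (Fin (suc k) → ℕ) →
      Fin (suc (suc k)) → Diff
    liftCoeffs e W k a t j = embed e (shiftedCoeffs W k a t j)

    lift-in-A : ∀ e W k a t {g} (cf : Cofactor W g) → A (xJ _∙_ k a t (numerator g cf)) →
      inDiff A (xJ _+D_ k (liftCoeffs e W k a t) t g)
    lift-in-A e W k a t {g} cf@(_ , qR≈W) As =
      _ , As , represents-xJ k (liftCoeffs e W k a t) a t g (numerator g cf) inner last
      where
      inner : ∀ j → (liftCoeffs e W k a t (inject₁ j) +D g (t j))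
                      represents (a (inject₁ j) ∙ numerator g cf (t j))
      inner j = represents-clear
        (subst (embed e (shiftedCoeffs W k a t (inject₁ j)) represents_)
               (snoc-inject₁ k _ _ j) (embed-represents e _))
        (qR≈W (t j))

      last : liftCoeffs e W k a t (fromℕ (suc k)) represents a (fromℕ (suc k))
      last = subst (embed e (shiftedCoeffs W k a t (fromℕ (suc k))) represents_)
                   (snoc-last k _ _) (embed-represents e _)

    J-set-lifts : IsJSet Sc _∙_ A → IsJSet Diff _+D_ (inDiff A)
    J-set-lifts J f₀ F with cofactors (proj₁ (f₀ 0)) (f₀ ∷ F)
    ... | c₀ ∷ cs =
      let (k , a , t , t-inc , inA) = J (numerator f₀ c₀) (reduce (λ {g} → numerator g) cs)
      in k , liftCoeffs e W k a t , t , t-inc ,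
         reduce⁻ (λ {g} → numerator g) (λ {g} → lift-in-A e W k a t {g}) (c₀ ∷ cs) inA
      where
      -- S need not have an identity, so a fixed element e of S is used to embed
      -- S into S - S and to start the common denominator.
      e : Sc
      e = proj₁ (f₀ 0)

      W : ℕ → Sc
      W = commonDenominator e (f₀ ∷ F)

theorem2p5 : ∀ {c ℓ ℓ'} (S : CommutativeSemigroup c ℓ) →
    Cancellative (CommutativeSemigroup._≈_ S) (CommutativeSemigroup._∙_ S) →
    (A : Pred (CommutativeSemigroup.Carrier S) ℓ') →
    IsJSet (CommutativeSemigroup.Carrier S) (CommutativeSemigroup._∙_ S) A →
    IsJSet (DifferenceGroup.Diff S) (DifferenceGroup._+D_ S) (DifferenceGroup.inDiff S A)
theorem2p5 S _ A = J-set-lifts S A
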